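{- Let $C$ be any composition of a positive integer $n$. Then $C$ is cyclic if and only if the repeated reduction procedure, applied to the balanced composition $\mathrm{eq}(C)$, stops at the composition $(1\,|\,1)$.
   Context: A composition of $n$ is a tuple $(a_1,\ldots,a_k)$ of positive integers with sum $n$. Its associated reverse layered permutation is $\pi = I_{a_1}\ominus I_{a_2}\ominus\cdots\ominus I_{a_k}$, where $I_a=12\cdots a$ is the identity and the skew sum of $\alpha\in\mathfrak{S}_p$, $\beta\in\mathfrak{S}_q$ is $(\alpha\ominus\beta)(i)=\alpha(i)+q$ for $i\le p$ and $(\alpha\ominus\beta)(i)=\beta(i-p)$ for $i>p$. Explicitly $\pi = (n-a_1+1)\cdots(n)\,(n-a_1-a_2+1)\cdots(n-a_1)\cdots(1)\cdots(a_k)$ in one-line notation. The composition is cyclic if $\pi$ is a single $n$-cycle. A composition is balanced if some prefix $a_1,\ldots,a_j$ has sum $n/2$; it is then written $(a_1,\ldots,a_k\,|\,b_m,\ldots,b_1)$, meaning the composition $(a_1,\ldots,a_k,b_m,\ldots,b_1)$ with $a_1+\cdots+a_k=b_1+\cdots+b_m=n/2$. Otherwise it is unbalanced. Reduction: for a balanced $C=(a_1,\ldots,a_k\,|\,b_m,\ldots,b_1)$ with $a_k\ne b_m$, let $D=|a_k-b_m|$, $u = a_k \bmod D\in\{0,\ldots,D-1\}$, $v=D-u$. If $a_k>b_m$, $\mathrm{red}(C)=(a_1,\ldots,a_{k-1},u,v\,|\,b_{m-1},\ldots,b_1)$; if $a_k<b_m$, $\mathrm{red}(C)=(a_1,\ldots,a_{k-1}\,|\,v,u,b_{m-1},\ldots,b_1)$;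 in both cases $u$ is omitted if $u=0$. The repeated reduction procedure applies $\mathrm{red}$ repeatedly to a balanced composition until the last entry before the bar equals the first entry after the bar, and then stops (this terminates since $\mathrm{red}$ strictly decreases the sum). Equalization: if $C=(a_1,\ldots,a_k)$ is unbalanced, its dividing index is the $i$ with $a_1+\cdots+a_{i-1}<n/2<a_1+\cdots+a_i$. Its nearly-equal division is $((a_1,\ldots,a_i),(a_{i+1},\ldots,a_k))$ if $a_1+\cdots+a_{i-1}\le a_{i+1}+\cdots+a_k$, and $((a_1,\ldots,a_{i-1}),(a_i,\ldots,a_k))$ otherwise. If the nearly-equal division is $((a_1,\ldots,a_j),(a_{j+1},\ldots,a_k))$, the unequalness is $U(C)=\left|\sum_{\ell=1}^j a_\ell-\sum_{\ell=j+1}^k a_\ell\right|$ and $\mathrm{eq}(C)=(a_1,\ldots,a_j,U(C),a_{j+1},\ldots,a_k)$, a balanced composition of $n+U(C)$ (with the bar placed at the position where the prefix sum is half the total). If $C$ is balanced, $\mathrm{eq}(C)=C$. -}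

module Defs where

open import Data.Nat using (ℕ; zero; suc; _+_; _*_; _∸_; _≤_; _<_; _≤?_; _<?_; _≟_; ∣_-_∣; compare; less; equal; greater; NonZero)
open import Data.Nat.DivMod using (_%_)
open import Data.List using (List; []; _∷_; _++_; reverse)
open import Data.Nat.ListAction using (sum)
open import Data.Maybe using (Maybe; just; nothing)
open import Data.Product using (_×_; _,_; proj₁; proj₂)
open import Relation.Nullary using (yes; no)
open import Relation.Binary.PropositionalEquality using (_≡_; _≢_)

-- Compositions are lists of naturals (positivity / sum imposed in the statement).

-- Reverse layered permutation, 1-indexed: position i in block j
-- (s_{j-1} < i ≤ s_j, s_j = a_1+…+a_j) is sent to n - s_j + (i - s_{j-1}).

permAux : ℕ → ℕ → List ℕ → ℕ → ℕ
permAux n s []       i = i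
permAux n s (a ∷ as) i with i ≤? s + a
... | yes _ = (n ∸ (s + a)) + (i ∸ s)
... | no  _ = permAux n (s + a) as i

revLayered : List ℕ → ℕ → ℕ
revLayered C = permAux (sum C) 0 C

iter : (ℕ → ℕ) → ℕ → ℕ → ℕ
iter f zero    x = x
iter f (suc k) x = f (iter f k x)

Cyclic : List ℕ → Set
Cyclic C = ∀ i j → 1 ≤ i → i ≤ sum C → 1 ≤ j → j ≤ sum C →
           Σℕ λ k → iter (revLayered C) k i ≡ j
  where
  open import Data.Product using (Σ)
  Σℕ : (ℕ → Set) → Set
  Σℕ P = Σ ℕ P

-- Balanced compositions are represented as a pair (Lr , R) where
-- Lr = [a_k , … , a_1] (the part before the bar, REVERSED) and
-- R  = [b_m , … , b_1] (the part after the bar, in order), so the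
-- underlying composition is  reverse Lr ++ R, i.e. (a_1,…,a_k | b_m,…,b_1).

splitAux : ℕ → List ℕ → ℕ → List ℕ → Maybe (List ℕ × List ℕ)
splitAux T acc s xs with 2 * s ≟ T
splitAux T acc s xs       | yes _ = just (acc , xs)
splitAux T acc s []       | no  _ = nothing
splitAux T acc s (a ∷ as) | no  _ = splitAux T (a ∷ acc) (s + a) as

splitHalf : List ℕ → Maybe (List ℕ × List ℕ)
splitHalf C = splitAux (sum C) [] 0 C

consNZ : ℕ → List ℕ → List ℕ
consNZ zero    xs = xs
consNZ (suc u) xs = suc u ∷ xs

-- one reduction step at a_k = a, b_m = b (a ≢ b); D = |a - b|,
-- u = a mod D, v = D - u, u omitted when 0.
red : ℕ → List ℕ → ℕ → List ℕ → List ℕ × List ℕ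
red a as b bs with compare a b
... | less    .a k = as , ((suc k ∸ (a % suc k)) ∷ consNZ (a % suc k) bs)
... | equal   .a   = (a ∷ as) , (b ∷ bs)
... | greater .b k = ((suc k ∸ (a % suc k)) ∷ consNZ (a % suc k) as) , bs

data RedStops : List ℕ → List ℕ → List ℕ → List ℕ → Set where
  stop : ∀ a as bs → RedStops (a ∷ as) (a ∷ bs) (a ∷ as) (a ∷ bs)
  step : ∀ a as b bs {L' R'} → a ≢ b →
         RedStops (proj₁ (red a as b bs)) (proj₂ (red a as b bs)) L' R' →
         RedStops (a ∷ as) (b ∷ bs) L' R'

eqAux : ℕ → List ℕ → ℕ → List ℕ → List ℕ
eqAux n acc s []       = reverse acc
eqAux n acc s (a ∷ rest) with n <? 2 * (s + a)
... | no  _ = eqAux n (a ∷ acc) (s + a) rest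
... | yes _ with s ≤? sum rest
...   | yes _ = reverse (a ∷ acc) ++ (∣ (s + a) - sum rest ∣ ∷ rest)
...   | no  _ = reverse acc ++ (∣ s - (a + sum rest) ∣ ∷ a ∷ rest)

eqC : List ℕ → List ℕ
eqC C with splitHalf C
... | just _  = C
... | nothing = eqAux (sum C) [] 0 C

module Submission where

-- For a composition C write π_C = I_a₁ ⊖ ⋯ ⊖ I_aₖ (revLayered C).  The whole proof
-- rests on one dynamical fact, the first-return principle: if a permutation f
-- of [1, N] carries every point outside a "gap" of w points to the next point
-- outside the gap through gap points only, and every gap point leaves the gap,
-- then f is cyclic iff its first-return map on the N - w remaining points is.
--
-- For E = P ++ U ∷ Q with U = ∣ sum P - sum Q ∣ the block U is such a gap of π_E
-- and the first-return map is π_(P ++ Q); so inserting U preserves cyclicity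
-- (insert-gap).  This is the equalization step, and the reduction step red is
-- a chain of such insertions and removals: in (… b + D | b …) the block b + D
-- is the gap between the two halves and ∣ b - D ∣ the gap behind b, so the pair
-- (b + D, b) may be replaced by (b, ∣ b - D ∣); this Euclidean descent ends at
-- (u, v) with u = b mod D, v = D - u (reduce-greater).  The case aₖ < bₘ follows
-- by reversing the composition, as π_(reverse C) = π_C⁻¹ (reduce-less).
-- Finally, in a stopping configuration (… a | a …) the permutation swaps two
-- points, so it is cyclic only for (1 | 1) (terminal).

open import Defs
open import Data.Nat
open import Data.Nat.Properties
open import Data.Nat.DivMod using (m%n<n; [m+n]%n≡m%n; m<n⇒m%n≡m; n%n≡0)
open import Data.Nat.Induction using (<-wellFounded)
open import Data.Nat.Tactic.RingSolver using (solve-∀)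
open import Data.Nat.ListAction using (sum)
open import Data.Nat.ListAction.Properties using (sum-++; sum-↭)
open import Algebra.Properties.CommutativeSemigroup +-commutativeSemigroup using (x∙yz≈y∙xz)
open import Induction.WellFounded using (Acc; acc)
open import Data.Fin using (Fin; toℕ; fromℕ<)
open import Data.Fin.Properties using (pigeonhole; toℕ-fromℕ<)
open import Data.List using (List; []; _∷_; _++_; reverse; [_])
open import Data.List.Properties using (unfold-reverse; reverse-++; reverse-involutive; ++-assoc)
open import Data.List.Relation.Unary.All using (All; _∷_; head; tail)
open import Data.List.Relation.Unary.All.Properties using (++⁺; ++⁻)
open import Data.List.Relation.Binary.Permutation.Propositional.Properties using (↭-reverse; All-resp-↭)
open import Data.Maybe using (just; nothing)
open import Data.Product using (Σ; _×_; _,_; proj₁; proj₂)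
open import Data.Sum using (_⊎_; inj₁; inj₂)
open import Data.Empty using (⊥-elim)
open import Relation.Nullary using (yes; no)
open import Relation.Binary using (tri<; tri≈; tri>)
open import Relation.Binary.PropositionalEquality hiding ([_])
open import Function.Bundles using (_⇔_; mk⇔; Equivalence)
import Function.Properties.Equivalence as ⇔
open import Level using (0ℓ)
import Relation.Binary.Reasoning.Setoid as SetoidReasoning

InR : ℕ → ℕ → Set
InR N x = 1 ≤ x × x ≤ N

CycOn : ℕ → (ℕ → ℕ) → Set
CycOn N f = ∀ i j → 1 ≤ i → i ≤ N → 1 ≤ j → j ≤ N → Σ ℕ λ k → iter f k i ≡ j

iter-+ : ∀ f k l x → iter f (k + l) x ≡ iter f k (iter f l x)
iter-+ f zero    l x = refl
iter-+ f (suc k) l x = cong f (iter-+ f k l x)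

iter-suc : ∀ f k x → iter f (suc k) x ≡ iter f k (f x)
iter-suc f k x = trans (cong (λ m → iter f m x) (+-comm 1 k)) (iter-+ f k 1 x)

iter-preserves : ∀ {P : ℕ → Set} f → (∀ z → P z → P (f z)) → ∀ k z → P z → P (iter f k z)
iter-preserves f pf zero    z pz = pz
iter-preserves f pf (suc k) z pz = pf _ (iter-preserves f pf k z pz)

swap-orbit : ∀ f {x y} → f x ≡ y → f y ≡ x → ∀ k → iter f k x ≡ x ⊎ iter f k x ≡ y
swap-orbit f fx≡y fy≡x zero = inj₁ refl
swap-orbit f fx≡y fy≡x (suc k) with swap-orbit f fx≡y fy≡x k
... | inj₁ e = inj₂ (trans (cong f e) fx≡y)
... | inj₂ e = inj₁ (trans (cong f e) fy≡x)

-- An injective self-map f of [1, N] is a permutation, so every iterate of it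
-- can be undone by a further iterate.
module FinitePermutation {N : ℕ} {f : ℕ → ℕ}
  (f-range : ∀ z → InR N z → InR N (f z))
  (f-inj : ∀ z z' → InR N z → InR N z' → f z ≡ f z' → z ≡ z') where

  iter-range : ∀ k z → InR N z → InR N (iter f k z)
  iter-range = iter-preserves f f-range

  cancel : ∀ y → InR N y → ∀ i d → iter f (i + d) y ≡ iter f i y → iter f d y ≡ y
  cancel y ry zero    d eq = eq
  cancel y ry (suc i) d eq =
    cancel y ry i d (f-inj _ _ (iter-range (i + d) y ry) (iter-range i y ry) eq)

  -- Pigeonhole on y, f y, …, f^N y gives a period of y.
  periodic : ∀ y → InR N y → Σ ℕ λ p → iter f (suc p) y ≡ y
  periodic y ry with pigeonhole (n<1+n N) code
    where
    code : Fin (suc N) → Fin N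
    code k = fromℕ< (pred-below (iter-range (toℕ k) y ry))
      where
      pred-below : ∀ {z} → InR N z → pred z < N
      pred-below {suc z} (_ , z<N) = z<N
  ... | i , j , i<j , same = d , cancel y ry (toℕ i) (suc d) (trans (cong (λ m → iter f m y) i+d≡j) (sym fi≡fj))
    where
    d : ℕ
    d = toℕ j ∸ suc (toℕ i)
    i+d≡j : toℕ i + suc d ≡ toℕ j
    i+d≡j = trans (+-suc (toℕ i) d) (m+[n∸m]≡n i<j)
    pred-inj : ∀ {a b} → 1 ≤ a → 1 ≤ b → pred a ≡ pred b → a ≡ b
    pred-inj {suc a} {suc b} _ _ e = cong suc e
    fi≡fj : iter f (toℕ i) y ≡ iter f (toℕ j) y
    fi≡fj = pred-inj (proj₁ (iter-range (toℕ i) y ry)) (proj₁ (iter-range (toℕ j) y ry))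
      (trans (sym (toℕ-fromℕ< _)) (trans (cong toℕ same) (toℕ-fromℕ< _)))

  undo : ∀ y t → InR N y → Σ ℕ λ m → iter f m (iter f t y) ≡ y
  undo y t ry = t * p , (begin
      iter f (t * p) (iter f t y) ≡⟨ iter-+ f (t * p) t y ⟨
      iter f (t * p + t) y        ≡⟨ cong (λ m → iter f m y) (trans (+-comm (t * p) t) (sym (*-suc t p))) ⟩
      iter f (t * suc p) y        ≡⟨ multiple t ⟩
      y                           ∎)
    where
    open ≡-Reasoning
    p : ℕ
    p = proj₁ (periodic y ry)
    multiple : ∀ c → iter f (c * suc p) y ≡ y
    multiple zero    = refl
    multiple (suc c) = trans (iter-+ f (suc p) (c * suc p) y)
                             (trans (cong (iter f (suc p)) (multiple c)) (proj₂ (periodic y ry)))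

-- embed M w maps [1, N'] into [1, N' + w] leaving out the gap (M, M + w]:
-- it is the identity up to M and a shift by w beyond M.
embed : ℕ → ℕ → ℕ → ℕ
embed M w x with x ≤? M
... | yes _ = x
... | no  _ = x + w

embed-≤ : ∀ M w x → x ≤ M → embed M w x ≡ x
embed-≤ M w x x≤M with x ≤? M
... | yes _   = refl
... | no  x≰M = ⊥-elim (x≰M x≤M)

embed-> : ∀ M w x → M < x → embed M w x ≡ x + w
embed-> M w x M<x with x ≤? M
... | yes x≤M = ⊥-elim (<⇒≱ M<x x≤M)
... | no  _   = refl

embed-inj : ∀ M w x y → embed M w x ≡ embed M w y → x ≡ y
embed-inj M w x y eq with x ≤? M | y ≤? M
... | yes _   | yes _   = eq
... | no  _   | no  _   = +-cancelʳ-≡ w x y eq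
... | yes x≤M | no  y≰M = ⊥-elim (<⇒≱ (≤-trans (≰⇒> y≰M) (m≤m+n y w)) (subst (_≤ M) eq x≤M))
... | no  x≰M | yes y≤M = ⊥-elim (<⇒≱ (≤-trans (≰⇒> x≰M) (m≤m+n x w)) (subst (_≤ M) (sym eq) y≤M))

embed-avoids-gap : ∀ M w z → M < z → z ≤ M + w → ∀ x → z ≢ embed M w x
embed-avoids-gap M w z M<z z≤M+w x eq with x ≤? M
... | yes x≤M = <⇒≱ M<z (subst (_≤ M) (sym eq) x≤M)
... | no  x≰M = <⇒≱ (+-monoˡ-< w (≰⇒> x≰M)) (subst (_≤ M + w) eq z≤M+w)

embed-range : ∀ {N N'} M w x → N' + w ≤ N → InR N' x → InR N (embed M w x)
embed-range M w x size (1≤x , x≤N') with x ≤? M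
... | yes _ = 1≤x , ≤-trans x≤N' (≤-trans (m≤m+n _ w) size)
... | no  _ = ≤-trans 1≤x (m≤m+n x w) , ≤-trans (+-monoˡ-≤ w x≤N') size

data GapPath (f : ℕ → ℕ) (M w : ℕ) : ℕ → ℕ → Set where
  last : ∀ x → GapPath f M w x (f x)
  via  : ∀ x {y} → M < f x → f x ≤ M + w → GapPath f M w (f x) y → GapPath f M w x y

GapPath-step : ∀ {f M w x y} → f x ≡ y → GapPath f M w x y
GapPath-step {f} {M} {w} {x} refl = last x

GapPath-through : ∀ {f M w x z y} → f x ≡ z → M < z → z ≤ M + w → GapPath f M w z y → GapPath f M w x y
GapPath-through {x = x} refl M<z z≤ path = via x M<z z≤ path

GapPath-iter : ∀ {f M w x y} → GapPath f M w x y → Σ ℕ λ t → iter f (suc t) x ≡ y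
GapPath-iter (last x) = 0 , refl
GapPath-iter {f} (via x _ _ path) with GapPath-iter path
... | t , eq = suc t , trans (iter-suc f (suc t) x) eq

GapPath-first : ∀ {f M w x y} → GapPath f M w x y → ∀ k z → iter f (suc k) x ≡ embed M w z →
                Σ ℕ λ k' → k' ≤ k × iter f k' y ≡ embed M w z
GapPath-first {f} (last x) k z eq = k , ≤-refl , trans (sym (iter-suc f k x)) eq
GapPath-first {f} {M} {w} (via x M< ≤M+w path) zero z eq = ⊥-elim (embed-avoids-gap M w (f x) M< ≤M+w z eq)
GapPath-first {f} (via x _ _ path) (suc k) z eq
  with GapPath-first path k z (trans (sym (iter-suc f (suc k) x)) eq)
... | k' , k'≤k , e = k' , m≤n⇒m≤1+n k'≤k , e

module FirstReturn {N N' M w : ℕ} {f g : ℕ → ℕ}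
  (f-range : ∀ z → InR N z → InR N (f z))
  (f-inj : ∀ z z' → InR N z → InR N z' → f z ≡ f z' → z ≡ z')
  (g-range : ∀ x → InR N' x → InR N' (g x))
  (size : N' + w ≤ N)
  (returns : ∀ x → InR N' x → GapPath f M w (embed M w x) (embed M w (g x)))
  (reaches : ∀ z → InR N z → Σ ℕ λ t → Σ ℕ λ x → InR N' x × iter f t z ≡ embed M w x)
  where

  open FinitePermutation f-range f-inj using (undo)

  project : ∀ k → Acc _<_ k → ∀ i j → InR N' i → iter f k (embed M w i) ≡ embed M w j →
            Σ ℕ λ k' → iter g k' i ≡ j
  project zero    _        i j _  eq = 0 , embed-inj M w i j eq
  project (suc k) (acc rs) i j ri eq with GapPath-first (returns i ri) k j eq
  ... | k' , k'≤k , e with project k' (rs (s≤s k'≤k)) (g i) j (g-range i ri) e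
  ... | k'' , e' = suc k'' , trans (iter-suc g k'' i) e'

  lift : ∀ k x → InR N' x → Σ ℕ λ K → iter f K (embed M w x) ≡ embed M w (iter g k x)
  lift zero    x rx = 0 , refl
  lift (suc k) x rx with lift k x rx
  ... | K , e with GapPath-iter (returns (iter g k x) (iter-preserves g g-range k x rx))
  ... | t , e' = suc t + K , trans (iter-+ f (suc t) K _) (trans (cong (iter f (suc t)) e) e')

  equivalence : CycOn N f ⇔ CycOn N' g
  equivalence = mk⇔ to from
    where
    to : CycOn N f → CycOn N' g
    to cyc i j 1≤i i≤N' 1≤j j≤N'
      with embed-range M w i size (1≤i , i≤N') | embed-range M w j size (1≤j , j≤N')
    ... | (a₁ , a₂) | (b₁ , b₂) with cyc (embed M w i) (embed M w j) a₁ a₂ b₁ b₂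
    ... | k , e = project k (<-wellFounded k) i j (1≤i , i≤N') e

    -- i reaches embed x₁, which reaches embed x₂ along g, which returns to j.
    from : CycOn N' g → CycOn N f
    from cyc i j 1≤i i≤N 1≤j j≤N
      with reaches i (1≤i , i≤N) | reaches j (1≤j , j≤N)
    ... | t₁ , x₁ , rx₁ , e₁ | t₂ , x₂ , rx₂ , e₂
      with cyc x₁ x₂ (proj₁ rx₁) (proj₂ rx₁) (proj₁ rx₂) (proj₂ rx₂)
    ... | k , ek with lift k x₁ rx₁ | undo j t₂ (1≤j , j≤N)
    ... | K , eK | m , em = m + (K + t₁) , (begin
        iter f (m + (K + t₁)) i        ≡⟨ iter-+ f m (K + t₁) i ⟩
        iter f m (iter f (K + t₁) i)   ≡⟨ cong (iter f m) (iter-+ f K t₁ i) ⟩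
        iter f m (iter f K (iter f t₁ i)) ≡⟨ cong (λ z → iter f m (iter f K z)) e₁ ⟩
        iter f m (iter f K (embed M w x₁)) ≡⟨ cong (iter f m) (trans eK (cong (embed M w) ek)) ⟩
        iter f m (embed M w x₂)        ≡⟨ cong (iter f m) e₂ ⟨
        iter f m (iter f t₂ j)         ≡⟨ em ⟩
        j                              ∎)
      where open ≡-Reasoning

≤-or-beyond : ∀ x a → x ≤ a ⊎ Σ ℕ λ j → 1 ≤ j × x ≡ a + j
≤-or-beyond x a with x ≤? a
... | yes x≤a = inj₁ x≤a
... | no  x≰a = inj₂ (x ∸ a , m<n⇒0<n∸m (≰⇒> x≰a) , sym (m+[n∸m]≡n (<⇒≤ (≰⇒> x≰a))))

sum-reverse : ∀ C → sum (reverse C) ≡ sum C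
sum-reverse C = sum-↭ (↭-reverse C)

reverse-around : ∀ (A : List ℕ) c B → reverse (A ++ c ∷ B) ≡ reverse B ++ c ∷ reverse A
reverse-around A c B =
  trans (reverse-++ A (c ∷ B)) (trans (cong (_++ reverse A) (unfold-reverse c B)) (++-assoc (reverse B) [ c ] (reverse A)))

reverse-around₂ : ∀ (A : List ℕ) c d B → reverse (A ++ c ∷ d ∷ B) ≡ reverse B ++ d ∷ c ∷ reverse A
reverse-around₂ A c d B =
  trans (reverse-around A c (d ∷ B))
        (trans (cong (_++ c ∷ reverse A) (reverse-around [] d B)) (++-assoc (reverse B) [ d ] (c ∷ reverse A)))

reverse-cons-++ : ∀ a (as : List ℕ) W → reverse (a ∷ as) ++ W ≡ reverse as ++ a ∷ W
reverse-cons-++ a as W = trans (cong (_++ W) (unfold-reverse a as)) (++-assoc (reverse as) [ a ] W)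

sum-consNZ : ∀ u W → sum (consNZ u W) ≡ u + sum W
sum-consNZ zero    W = refl
sum-consNZ (suc u) W = refl

reverse-around-consNZ : ∀ (A : List ℕ) v u B → reverse (A ++ v ∷ consNZ u B) ≡ reverse B ++ consNZ u (v ∷ reverse A)
reverse-around-consNZ A v zero    B = reverse-around A v B
reverse-around-consNZ A v (suc u) B = reverse-around₂ A v (suc u) B

reverse-consNZ-++ : ∀ u (as : List ℕ) W → reverse (consNZ u as) ++ W ≡ reverse as ++ consNZ u W
reverse-consNZ-++ zero    as W = refl
reverse-consNZ-++ (suc u) as W = reverse-cons-++ (suc u) as W

Positive : List ℕ → Set
Positive = All (0 <_)

positive-consNZ : ∀ u {W} → Positive W → Positive (consNZ u W)
positive-consNZ zero    pos = pos
positive-consNZ (suc u) pos = z<s ∷ pos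

positive-reverse⁻ : ∀ xs → Positive (reverse xs) → Positive xs
positive-reverse⁻ xs = All-resp-↭ (↭-reverse xs)

positive-sum-zero : ∀ xs → Positive xs → sum xs ≡ 0 → xs ≡ []
positive-sum-zero []       _          _  = refl
positive-sum-zero (x ∷ xs) (0<x ∷ _) eq = ⊥-elim (<⇒≢ 0<x (sym (m+n≡0⇒m≡0 x eq)))

permAux-shift : ∀ k n s Y i → s < i → i ≤ s + sum Y →
                permAux (k + n) (k + s) Y (k + i) ≡ permAux n s Y i
permAux-shift k n s [] i s<i i≤s+0 = ⊥-elim (<⇒≱ s<i (subst (i ≤_) (+-identityʳ s) i≤s+0))
permAux-shift k n s (a ∷ Y) i s<i i≤ with k + i ≤? k + s + a | i ≤? s + a
... | yes _ | yes _ = cong₂ _+_ (trans (cong (k + n ∸_) (+-assoc k s a)) ([m+n]∸[m+o]≡n∸o k n (s + a)))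
                                ([m+n]∸[m+o]≡n∸o k i s)
... | no  _ | no i≰ = trans (cong (λ t → permAux (k + n) t Y (k + i)) (+-assoc k s a))
                            (permAux-shift k n (s + a) Y i (≰⇒> i≰) (subst (i ≤_) (sym (+-assoc s a (sum Y))) i≤))
... | yes p | no  q = ⊥-elim (q (+-cancelˡ-≤ k i (s + a) (subst (k + i ≤_) (+-assoc k s a) p)))
... | no  p | yes q = ⊥-elim (p (subst (k + i ≤_) (sym (+-assoc k s a)) (+-monoʳ-≤ k q)))

revLayered-first : ∀ c Y y → y ≤ c → revLayered (c ∷ Y) y ≡ sum Y + y
revLayered-first c Y y y≤c with y ≤? c
... | yes _   = cong (_+ y) (m+n∸m≡n c (sum Y))
... | no  y≰c = ⊥-elim (y≰c y≤c)

revLayered-rest : ∀ c Y y → InR (sum Y) y → revLayered (c ∷ Y) (c + y) ≡ revLayered Y y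
revLayered-rest c Y y (1≤y , y≤) with c + y ≤? c
... | yes c+y≤c = ⊥-elim (<⇒≱ (m<m+n c 1≤y) c+y≤c)
... | no  _     = trans (cong (λ s → permAux (c + sum Y) s Y (c + y)) (sym (+-identityʳ c)))
                        (permAux-shift c (sum Y) 0 Y y 1≤y y≤)

revLayered-++ˡ : ∀ X Y x → InR (sum X) x → revLayered (X ++ Y) x ≡ sum Y + revLayered X x
revLayered-++ˡ [] Y x (1≤x , x≤0) = ⊥-elim (<⇒≱ 1≤x x≤0)
revLayered-++ˡ (a ∷ X) Y x (1≤x , x≤) with ≤-or-beyond x a
... | inj₁ x≤a = begin
  revLayered (a ∷ X ++ Y) x ≡⟨ revLayered-first a (X ++ Y) x x≤a ⟩
  sum (X ++ Y) + x          ≡⟨ cong (_+ x) (trans (sum-++ X Y) (+-comm (sum X) (sum Y))) ⟩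
  sum Y + sum X + x         ≡⟨ +-assoc (sum Y) (sum X) x ⟩
  sum Y + (sum X + x)       ≡⟨ cong (sum Y +_) (revLayered-first a X x x≤a) ⟨
  sum Y + revLayered (a ∷ X) x ∎
  where open ≡-Reasoning
... | inj₂ (j , 1≤j , refl) = begin
  revLayered (a ∷ X ++ Y) (a + j) ≡⟨ revLayered-rest a (X ++ Y) j (1≤j , j≤X++Y) ⟩
  revLayered (X ++ Y) j           ≡⟨ revLayered-++ˡ X Y j (1≤j , j≤X) ⟩
  sum Y + revLayered X j          ≡⟨ cong (sum Y +_) (revLayered-rest a X j (1≤j , j≤X)) ⟨
  sum Y + revLayered (a ∷ X) (a + j) ∎
  where
  open ≡-Reasoning
  j≤X : j ≤ sum X
  j≤X = +-cancelˡ-≤ a j (sum X) x≤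
  j≤X++Y : j ≤ sum (X ++ Y)
  j≤X++Y = subst (j ≤_) (sym (sum-++ X Y)) (≤-trans j≤X (m≤m+n (sum X) (sum Y)))

revLayered-++ʳ : ∀ X Y y → InR (sum Y) y → revLayered (X ++ Y) (sum X + y) ≡ revLayered Y y
revLayered-++ʳ []      Y y ry = refl
revLayered-++ʳ (a ∷ X) Y y (1≤y , y≤) =
  trans (cong (revLayered (a ∷ X ++ Y)) (+-assoc a (sum X) y))
        (trans (revLayered-rest a (X ++ Y) (sum X + y) (≤-trans 1≤y (m≤n+m y (sum X)) , X+y≤))
               (revLayered-++ʳ X Y y (1≤y , y≤)))
  where
  X+y≤ : sum X + y ≤ sum (X ++ Y)
  X+y≤ = subst (sum X + y ≤_) (sym (sum-++ X Y)) (+-monoʳ-≤ (sum X) y≤)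

revLayered-range : ∀ C i → InR (sum C) i → InR (sum C) (revLayered C i)
revLayered-range [] i (1≤i , i≤0) = ⊥-elim (<⇒≱ 1≤i i≤0)
revLayered-range (a ∷ C) i (1≤i , i≤) with ≤-or-beyond i a
... | inj₁ i≤a = subst (InR (a + sum C)) (sym (revLayered-first a C i i≤a))
                   (≤-trans 1≤i (m≤n+m i (sum C)) , subst (sum C + i ≤_) (+-comm (sum C) a) (+-monoʳ-≤ (sum C) i≤a))
... | inj₂ (j , 1≤j , refl) with revLayered-range C j (1≤j , +-cancelˡ-≤ a j (sum C) i≤)
...   | (1≤π , π≤) = subst (InR (a + sum C)) (sym (revLayered-rest a C j (1≤j , +-cancelˡ-≤ a j (sum C) i≤)))
                       (1≤π , ≤-trans π≤ (m≤n+m (sum C) a))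

revLayered-inverse : ∀ C i → InR (sum C) i → revLayered (reverse C) (revLayered C i) ≡ i
revLayered-inverse [] i (1≤i , i≤0) = ⊥-elim (<⇒≱ 1≤i i≤0)
revLayered-inverse (a ∷ C) i (1≤i , i≤) rewrite unfold-reverse a C with ≤-or-beyond i a
... | inj₁ i≤a = begin
  revLayered (reverse C ++ [ a ]) (revLayered (a ∷ C) i)   ≡⟨ cong (revLayered (reverse C ++ [ a ])) (revLayered-first a C i i≤a) ⟩
  revLayered (reverse C ++ [ a ]) (sum C + i)              ≡⟨ cong (λ s → revLayered (reverse C ++ [ a ]) (s + i)) (sum-reverse C) ⟨
  revLayered (reverse C ++ [ a ]) (sum (reverse C) + i)    ≡⟨ revLayered-++ʳ (reverse C) [ a ] i (1≤i , subst (i ≤_) (sym (+-identityʳ a)) i≤a) ⟩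
  revLayered [ a ] i                                       ≡⟨ revLayered-first a [] i i≤a ⟩
  i                                                        ∎
  where open ≡-Reasoning
... | inj₂ (j , 1≤j , refl) = begin
  revLayered (reverse C ++ [ a ]) (revLayered (a ∷ C) (a + j)) ≡⟨ cong (revLayered (reverse C ++ [ a ])) (revLayered-rest a C j rj) ⟩
  revLayered (reverse C ++ [ a ]) z                           ≡⟨ revLayered-++ˡ (reverse C) [ a ] z (subst (λ n → InR n z) (sym (sum-reverse C)) (revLayered-range C j rj)) ⟩
  (a + 0) + revLayered (reverse C) z                          ≡⟨ cong₂ _+_ (+-identityʳ a) (revLayered-inverse C j rj) ⟩
  a + j                                                       ∎
  where
  open ≡-Reasoning
  rj : InR (sum C) j
  rj = 1≤j , +-cancelˡ-≤ a j (sum C) i≤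
  z : ℕ
  z = revLayered C j

revLayered-inj : ∀ C i j → InR (sum C) i → InR (sum C) j → revLayered C i ≡ revLayered C j → i ≡ j
revLayered-inj C i j ri rj eq =
  trans (sym (revLayered-inverse C i ri)) (trans (cong (revLayered (reverse C)) eq) (revLayered-inverse C j rj))

module ⇔-Reasoning = SetoidReasoning (⇔.⇔-setoid 0ℓ)

-- π_(reverse C) is the inverse of π_C, and a permutation is cyclic iff its
-- inverse is.
Cyclic-reverse : ∀ C → Cyclic C → Cyclic (reverse C)
Cyclic-reverse C cyc i j 1≤i i≤ 1≤j j≤ =
  let k , πᵏj≡i = cyc j i 1≤j (≤C j≤) 1≤i (≤C i≤)
  in k , trans (cong (iter (revLayered (reverse C)) k) (sym πᵏj≡i)) (undo k j (1≤j , ≤C j≤))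
  where
  ≤C : ∀ {x} → x ≤ sum (reverse C) → x ≤ sum C
  ≤C = subst (_ ≤_) (sum-reverse C)
  undo : ∀ k x → InR (sum C) x → iter (revLayered (reverse C)) k (iter (revLayered C) k x) ≡ x
  undo zero    x rx = refl
  undo (suc k) x rx = begin
    iter π⁻¹ (suc k) (π (iter π k x)) ≡⟨ iter-suc π⁻¹ k _ ⟩
    iter π⁻¹ k (π⁻¹ (π (iter π k x))) ≡⟨ cong (iter π⁻¹ k) (revLayered-inverse C _ (iter-preserves π (revLayered-range C) k x rx)) ⟩
    iter π⁻¹ k (iter π k x)           ≡⟨ undo k x rx ⟩
    x                                 ∎
    where
    open ≡-Reasoning
    π π⁻¹ : ℕ → ℕ
    π = revLayered C
    π⁻¹ = revLayered (reverse C)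

Cyclic-reverse⇔ : ∀ C → Cyclic C ⇔ Cyclic (reverse C)
Cyclic-reverse⇔ C = mk⇔ (Cyclic-reverse C) (λ cyc → subst Cyclic (reverse-involutive C) (Cyclic-reverse (reverse C) cyc))

-- With M = sum P, the points of the inserted block form the gap (M, M + U]
-- of π_E, E = P ++ U ∷ Q: every orbit crosses it in at most one step, and the
-- first-return map on the remaining points is π_C, C = P ++ Q.
module GapInsertion (P Q : List ℕ) (U : ℕ) (balance : sum P ≡ sum Q + U) where
  t M : ℕ
  t = sum Q
  M = t + U
  E C : List ℕ
  E = P ++ U ∷ Q
  C = P ++ Q
  f g πP πQ : ℕ → ℕ
  f = revLayered E
  g = revLayered C
  πP = revLayered P
  πQ = revLayered Q

  sumE : sum E ≡ M + (U + t)
  sumE = trans (sum-++ P (U ∷ Q)) (cong (_+ (U + t)) balance)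

  sumC : sum C ≡ M + t
  sumC = trans (sum-++ P Q) (cong (_+ t) balance)

  inP : ∀ {x} → InR M x → InR (sum P) x
  inP (1≤x , x≤M) = 1≤x , subst (_ ≤_) (sym balance) x≤M

  πP-range : ∀ x → InR M x → InR M (πP x)
  πP-range x rx = subst (λ n → InR n (πP x)) balance (revLayered-range P x (inP rx))

  f-left : ∀ x → InR M x → f x ≡ (U + t) + πP x
  f-left x rx = revLayered-++ˡ P (U ∷ Q) x (inP rx)

  f-gap : ∀ y → InR U y → f (M + y) ≡ t + y
  f-gap y (1≤y , y≤U) = begin
    f (M + y)           ≡⟨ cong (λ s → f (s + y)) balance ⟨
    f (sum P + y)       ≡⟨ revLayered-++ʳ P (U ∷ Q) y (1≤y , ≤-trans y≤U (m≤m+n U t)) ⟩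
    revLayered (U ∷ Q) y ≡⟨ revLayered-first U Q y y≤U ⟩
    t + y               ∎
    where open ≡-Reasoning

  f-right : ∀ y → InR t y → f (M + y + U) ≡ πQ y
  f-right y (1≤y , y≤t) = begin
    f (M + y + U)              ≡⟨ cong f (trans (+-assoc M y U) (cong (M +_) (+-comm y U))) ⟩
    f (M + (U + y))            ≡⟨ cong (λ s → f (s + (U + y))) balance ⟨
    f (sum P + (U + y))        ≡⟨ revLayered-++ʳ P (U ∷ Q) (U + y) (≤-trans 1≤y (m≤n+m y U) , +-monoʳ-≤ U y≤t) ⟩
    revLayered (U ∷ Q) (U + y) ≡⟨ revLayered-rest U Q y (1≤y , y≤t) ⟩
    πQ y                       ∎
    where open ≡-Reasoning

  g-left : ∀ x → InR M x → g x ≡ t + πP x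
  g-left x rx = revLayered-++ˡ P Q x (inP rx)

  g-right : ∀ y → InR t y → g (M + y) ≡ πQ y
  g-right y ry = trans (cong (λ s → g (s + y)) (sym balance)) (revLayered-++ʳ P Q y ry)

  returns-via-gap : ∀ x → InR M x → πP x ≤ U → GapPath f M U (embed M U x) (embed M U (g x))
  returns-via-gap x rx@(_ , x≤M) π≤U =
    subst₂ (GapPath f M U) (sym (embed-≤ M U x x≤M)) (sym g-end)
      (GapPath-through (trans (f-left x rx) (cong (_+ πP x) (+-comm U t)))
        (m<m+n M 1≤π) (+-monoʳ-≤ M π≤U) (GapPath-step (f-gap (πP x) (1≤π , π≤U))))
    where
    1≤π : 1 ≤ πP x
    1≤π = proj₁ (πP-range x rx)
    g-end : embed M U (g x) ≡ t + πP x
    g-end = trans (cong (embed M U) (g-left x rx)) (embed-≤ M U _ (+-monoʳ-≤ t π≤U))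

  returns-directly : ∀ x → InR M x → ∀ π' → 1 ≤ π' → πP x ≡ U + π' →
                     GapPath f M U (embed M U x) (embed M U (g x))
  returns-directly x rx@(_ , x≤M) π' 1≤π' π≡ =
    subst₂ (GapPath f M U) (sym (embed-≤ M U x x≤M)) (sym g-end)
      (GapPath-step (trans (f-left x rx) (cong (U + t +_) π≡)))
    where
    shuffle : ∀ t U π' → U + t + (U + π') ≡ t + (U + π') + U
    shuffle = solve-∀
    g-end : embed M U (g x) ≡ U + t + (U + π')
    g-end = begin
      embed M U (g x)             ≡⟨ cong (embed M U) (trans (g-left x rx) (cong (t +_) π≡)) ⟩
      embed M U (t + (U + π'))    ≡⟨ embed-> M U _ (subst (M <_) (+-assoc t U π') (m<m+n M 1≤π')) ⟩
      t + (U + π') + U            ≡⟨ shuffle t U π' ⟨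
      U + t + (U + π')            ∎
      where open ≡-Reasoning

  returns-right : ∀ y → InR t y → GapPath f M U (embed M U (M + y)) (embed M U (g (M + y)))
  returns-right y ry@(1≤y , _) =
    subst₂ (GapPath f M U) (sym (embed-> M U (M + y) (m<m+n M 1≤y))) (sym g-end)
      (GapPath-step (f-right y ry))
    where
    g-end : embed M U (g (M + y)) ≡ πQ y
    g-end = trans (cong (embed M U) (g-right y ry))
                  (embed-≤ M U _ (≤-trans (proj₂ (revLayered-range Q y ry)) (m≤m+n t U)))

  returns : ∀ x → InR (sum C) x → GapPath f M U (embed M U x) (embed M U (g x))
  returns x (1≤x , x≤) with ≤-or-beyond x M
  ... | inj₁ x≤M with ≤-or-beyond (πP x) U
  ...   | inj₁ π≤U                = returns-via-gap x (1≤x , x≤M) π≤U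
  ...   | inj₂ (π' , 1≤π' , π≡)   = returns-directly x (1≤x , x≤M) π' 1≤π' π≡
  returns x (1≤x , x≤) | inj₂ (y , 1≤y , refl) =
    returns-right y (1≤y , +-cancelˡ-≤ M y t (subst (M + y ≤_) sumC x≤))

  reaches : ∀ z → InR (sum E) z → Σ ℕ λ k → Σ ℕ λ x → InR (sum C) x × iter f k z ≡ embed M U x
  reaches z (1≤z , z≤) with ≤-or-beyond z M
  ... | inj₁ z≤M = 0 , z , (1≤z , subst (z ≤_) (sym sumC) (≤-trans z≤M (m≤m+n M t))) , sym (embed-≤ M U z z≤M)
  ... | inj₂ (k , 1≤k , refl) with ≤-or-beyond k U
  ...   | inj₁ k≤U = 1 , t + k , (≤-trans 1≤k (m≤n+m k t) , subst (t + k ≤_) (sym sumC) t+k≤) ,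
                     trans (f-gap k (1≤k , k≤U)) (sym (embed-≤ M U (t + k) (+-monoʳ-≤ t k≤U)))
    where
    t+k≤ : t + k ≤ M + t
    t+k≤ = subst (t + k ≤_) (+-comm t M) (+-monoʳ-≤ t (≤-trans k≤U (m≤n+m U t)))
  ...   | inj₂ (k' , 1≤k' , refl) = 0 , M + k' , (≤-trans 1≤k' (m≤n+m k' M) , subst (M + k' ≤_) (sym sumC) (+-monoʳ-≤ M k'≤t)) ,
                     trans (trans (cong (M +_) (+-comm U k')) (sym (+-assoc M k' U))) (sym (embed-> M U (M + k') (m<m+n M 1≤k')))
    where
    k'≤t : k' ≤ t
    k'≤t = +-cancelˡ-≤ U k' t (+-cancelˡ-≤ M (U + k') (U + t) (subst (M + (U + k') ≤_) sumE z≤))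

  equivalence : Cyclic E ⇔ Cyclic C
  equivalence = FirstReturn.equivalence {N = sum E} {N' = sum C} {M = M} {w = U} {f = f} {g = g}
    (revLayered-range E) (revLayered-inj E) (revLayered-range C) size returns reaches
    where
    size : sum C + U ≤ sum E
    size = ≤-reflexive (begin
      sum C + U     ≡⟨ cong (_+ U) sumC ⟩
      M + t + U     ≡⟨ +-assoc M t U ⟩
      M + (t + U)   ≡⟨ cong (M +_) (+-comm t U) ⟩
      M + (U + t)   ≡⟨ sumE ⟨
      sum E         ∎)
      where open ≡-Reasoning

-- The case sum P ≤ sum Q follows from the case
-- sum P ≥ sum Q by reversing the composition.
insert-gap : ∀ P Q → Cyclic (P ++ ∣ sum P - sum Q ∣ ∷ Q) ⇔ Cyclic (P ++ Q)
insert-gap P Q with ≤-total (sum Q) (sum P)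
... | inj₁ Q≤P rewrite m≤n⇒∣n-m∣≡n∸m Q≤P =
  GapInsertion.equivalence P Q (sum P ∸ sum Q) (sym (m+[n∸m]≡n Q≤P))
... | inj₂ P≤Q rewrite m≤n⇒∣m-n∣≡n∸m P≤Q = begin
  Cyclic (P ++ U ∷ Q)                     ≈⟨ Cyclic-reverse⇔ (P ++ U ∷ Q) ⟩
  Cyclic (reverse (P ++ U ∷ Q))           ≡⟨ cong Cyclic (reverse-around P U Q) ⟩
  Cyclic (reverse Q ++ U ∷ reverse P)     ≈⟨ GapInsertion.equivalence (reverse Q) (reverse P) U balance ⟩
  Cyclic (reverse Q ++ reverse P)         ≡⟨ cong Cyclic (reverse-++ P Q) ⟨
  Cyclic (reverse (P ++ Q))               ≈⟨ Cyclic-reverse⇔ (P ++ Q) ⟨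
  Cyclic (P ++ Q)                         ∎
  where
  open ⇔-Reasoning
  U : ℕ
  U = sum Q ∸ sum P
  balance : sum (reverse Q) ≡ sum (reverse P) + U
  balance = trans (sum-reverse Q) (trans (sym (m+[n∸m]≡n P≤Q)) (cong (_+ U) (sym (sum-reverse P))))

insert-block : ∀ P Q U → U ≡ ∣ sum P - sum Q ∣ → Cyclic (P ++ U ∷ Q) ⇔ Cyclic (P ++ Q)
insert-block P Q U refl = insert-gap P Q

-- In a balanced configuration X ++ (b + D) ∷ b ∷ Y with sum Y = sum X + D the
-- block b + D is exactly the gap between X and b ∷ Y, so it can be removed ...
drop-greater : ∀ X Y D b → sum Y ≡ sum X + D → Cyclic (X ++ (b + D) ∷ b ∷ Y) ⇔ Cyclic (X ++ b ∷ Y)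
drop-greater X Y D b balance = insert-block X (b ∷ Y) (b + D) (sym (begin
  ∣ sum X - b + sum Y ∣         ≡⟨ cong (λ s → ∣ sum X - b + s ∣) balance ⟩
  ∣ sum X - b + (sum X + D) ∣   ≡⟨ cong (∣ sum X -_∣) (x∙yz≈y∙xz b (sum X) D) ⟩
  ∣ sum X - sum X + (b + D) ∣   ≡⟨ ∣m-m+n∣≡n (sum X) (b + D) ⟩
  b + D                         ∎))
  where open ≡-Reasoning

-- ... and the gap ∣ b - D ∣ between X ++ [ b ] and Y can be inserted.
grow-greater : ∀ X Y D b → sum Y ≡ sum X + D → Cyclic (X ++ b ∷ Y) ⇔ Cyclic (X ++ b ∷ ∣ b - D ∣ ∷ Y)
grow-greater X Y D b balance = ⇔.sym (subst₂ (λ L L' → Cyclic L ⇔ Cyclic L')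
  (++-assoc X [ b ] (∣ b - D ∣ ∷ Y)) (++-assoc X [ b ] Y)
  (insert-block (X ++ [ b ]) Y ∣ b - D ∣ (sym (begin
    ∣ sum (X ++ [ b ]) - sum Y ∣ ≡⟨ cong₂ ∣_-_∣ (trans (sum-++ X [ b ]) (cong (sum X +_) (+-identityʳ b))) balance ⟩
    ∣ sum X + b - sum X + D ∣    ≡⟨ ∣m+n-m+o∣≡∣n-o∣ (sum X) b D ⟩
    ∣ b - D ∣                    ∎))))
  where open ≡-Reasoning

-- Dropping b + D and growing ∣ b - D ∣ either finishes (b ≤ D) or yields the same
-- configuration with b - D in place of b, which has the same residue.
reduce-greater : ∀ X Y D b .{{_ : NonZero D}} → 1 ≤ b → sum Y ≡ sum X + D →
  Cyclic (X ++ (b + D) ∷ b ∷ Y) ⇔ Cyclic (X ++ consNZ (b % D) ((D ∸ b % D) ∷ Y))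
reduce-greater X Y D b 1≤b balance = go b (<-wellFounded b) 1≤b
  where
  open ⇔-Reasoning
  go : ∀ b → Acc _<_ b → 1 ≤ b → Cyclic (X ++ (b + D) ∷ b ∷ Y) ⇔ Cyclic (X ++ consNZ (b % D) ((D ∸ b % D) ∷ Y))
  go zero _ ()
  go b@(suc _) (acc rs) _ with <-cmp b D
  ... | tri< b<D _ _ rewrite m<n⇒m%n≡m b<D = begin
    Cyclic (X ++ (b + D) ∷ b ∷ Y)     ≈⟨ drop-greater X Y D b balance ⟩
    Cyclic (X ++ b ∷ Y)               ≈⟨ grow-greater X Y D b balance ⟩
    Cyclic (X ++ b ∷ ∣ b - D ∣ ∷ Y)   ≡⟨ cong (λ v → Cyclic (X ++ b ∷ v ∷ Y)) (m≤n⇒∣m-n∣≡n∸m (<⇒≤ b<D)) ⟩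
    Cyclic (X ++ b ∷ (D ∸ b) ∷ Y)     ∎
  ... | tri≈ _ refl _ = begin
    Cyclic (X ++ (b + b) ∷ b ∷ Y)                      ≈⟨ drop-greater X Y b b balance ⟩
    Cyclic (X ++ b ∷ Y)                                ≡⟨ cong (λ u → Cyclic (X ++ consNZ u ((b ∸ u) ∷ Y))) (n%n≡0 b) ⟨
    Cyclic (X ++ consNZ (b % b) ((b ∸ b % b) ∷ Y))     ∎
  ... | tri> _ _ D<b = begin
    Cyclic (X ++ (b + D) ∷ b ∷ Y)                      ≈⟨ drop-greater X Y D b balance ⟩
    Cyclic (X ++ b ∷ Y)                                ≈⟨ grow-greater X Y D b balance ⟩
    Cyclic (X ++ b ∷ ∣ b - D ∣ ∷ Y)                    ≡⟨ cong₂ (λ p q → Cyclic (X ++ p ∷ q ∷ Y)) (sym b'+D≡b) (m≤n⇒∣n-m∣≡n∸m D≤b) ⟩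
    Cyclic (X ++ (b' + D) ∷ b' ∷ Y)                    ≈⟨ go b' (rs (∸-monoʳ-< (>-nonZero⁻¹ D) D≤b)) (m<n⇒0<n∸m D<b) ⟩
    Cyclic (X ++ consNZ (b' % D) ((D ∸ b' % D) ∷ Y))   ≡⟨ cong (λ u → Cyclic (X ++ consNZ u ((D ∸ u) ∷ Y))) same-residue ⟩
    Cyclic (X ++ consNZ (b % D) ((D ∸ b % D) ∷ Y))     ∎
    where
    D≤b : D ≤ b
    D≤b = <⇒≤ D<b
    b' : ℕ
    b' = b ∸ D
    b'+D≡b : b' + D ≡ b
    b'+D≡b = m∸n+n≡m D≤b
    same-residue : b' % D ≡ b % D
    same-residue = trans (sym ([m+n]%n≡m%n b' D)) (cong (_% D) b'+D≡b)

-- The reduction step for a_k = a < b_m = a + D: by reversing the composition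
-- it becomes the previous case, and X ++ a ∷ (a + D) ∷ Y reduces to
-- X ++ v ∷ u ∷ Y with u = a mod D, v = D - u.
reduce-less : ∀ X Y D a .{{_ : NonZero D}} → 1 ≤ a → sum X ≡ sum Y + D →
  Cyclic (X ++ a ∷ (a + D) ∷ Y) ⇔ Cyclic (X ++ (D ∸ a % D) ∷ consNZ (a % D) Y)
reduce-less X Y D a 1≤a balance = begin
  Cyclic (X ++ a ∷ (a + D) ∷ Y)                            ≈⟨ Cyclic-reverse⇔ (X ++ a ∷ (a + D) ∷ Y) ⟩
  Cyclic (reverse (X ++ a ∷ (a + D) ∷ Y))                  ≡⟨ cong Cyclic (reverse-around₂ X a (a + D) Y) ⟩
  Cyclic (reverse Y ++ (a + D) ∷ a ∷ reverse X)            ≈⟨ reduce-greater (reverse Y) (reverse X) D a 1≤a balance′ ⟩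
  Cyclic (reverse Y ++ consNZ u (v ∷ reverse X))           ≡⟨ cong Cyclic (reverse-around-consNZ X v u Y) ⟨
  Cyclic (reverse (X ++ v ∷ consNZ u Y))                   ≈⟨ Cyclic-reverse⇔ (X ++ v ∷ consNZ u Y) ⟨
  Cyclic (X ++ v ∷ consNZ u Y)                             ∎
  where
  open ⇔-Reasoning
  u v : ℕ
  u = a % D
  v = D ∸ u
  balance′ : sum (reverse X) ≡ sum (reverse Y) + D
  balance′ = trans (sum-reverse X) (trans balance (cong (_+ D) (sym (sum-reverse Y))))

-- (L | R) is a balanced composition (L stored reversed) with positive entries
-- and nonempty halves.
record Balanced (L R : List ℕ) : Set where
  field
    pos-left  : Positive L
    pos-right : Positive R
    halves    : sum L ≡ sum R
    nonempty  : 1 ≤ sum L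

record ReductionStep (L R L' R' : List ℕ) : Set where
  field
    same-cyclicity : Cyclic (reverse L ++ R) ⇔ Cyclic (reverse L' ++ R')
    balanced       : Balanced L' R'
    smaller        : sum L' < sum L

v-positive : ∀ a D .{{_ : NonZero D}} → 1 ≤ D ∸ a % D
v-positive a D = m<n⇒0<n∸m (m%n<n a D)

v+u≡D : ∀ a D .{{_ : NonZero D}} → (D ∸ a % D) + a % D ≡ D
v+u≡D a D = m∸n+n≡m (<⇒≤ (m%n<n a D))

halves-differ : ∀ a D s s' → a + s ≡ a + D + s' → s ≡ D + s'
halves-differ a D s s' eq = +-cancelˡ-≡ a s (D + s') (trans eq (+-assoc a D s'))

red-less-step : ∀ a as k bs → Balanced (a ∷ as) (suc (a + k) ∷ bs) →
  ReductionStep (a ∷ as) (suc (a + k) ∷ bs) as ((suc k ∸ a % suc k) ∷ consNZ (a % suc k) bs)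
red-less-step a as k bs bal = record
  { same-cyclicity = begin
      Cyclic (reverse (a ∷ as) ++ suc (a + k) ∷ bs)       ≡⟨ cong Cyclic (reverse-cons-++ a as _) ⟩
      Cyclic (reverse as ++ a ∷ suc (a + k) ∷ bs)         ≡⟨ cong (λ c → Cyclic (reverse as ++ a ∷ c ∷ bs)) (+-suc a k) ⟨
      Cyclic (reverse as ++ a ∷ (a + D) ∷ bs)             ≈⟨ reduce-less (reverse as) bs D a 1≤a balance ⟩
      Cyclic (reverse as ++ v ∷ consNZ u bs)              ∎
  ; balanced = record
      { pos-left  = tail pos-left
      ; pos-right = v-positive a D ∷ positive-consNZ u (tail pos-right)
      ; halves    = trans sum-as (sym sum-right)
      ; nonempty  = subst (1 ≤_) (sym sum-as) (m≤m+n 1 (k + sum bs))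
      }
  ; smaller = m<n+m (sum as) 1≤a
  }
  where
  open ⇔-Reasoning
  open Balanced bal
  D u v : ℕ
  D = suc k
  u = a % D
  v = D ∸ u
  1≤a : 1 ≤ a
  1≤a = head pos-left
  sum-as : sum as ≡ D + sum bs
  sum-as = halves-differ a D (sum as) (sum bs) (trans halves (cong (_+ sum bs) (sym (+-suc a k))))
  balance : sum (reverse as) ≡ sum bs + D
  balance = trans (sum-reverse as) (trans sum-as (+-comm D (sum bs)))
  sum-right : v + sum (consNZ u bs) ≡ D + sum bs
  sum-right = trans (cong (v +_) (sum-consNZ u bs)) (trans (sym (+-assoc v u (sum bs))) (cong (_+ sum bs) (v+u≡D a D)))

red-greater-step : ∀ b as k bs → Balanced (suc (b + k) ∷ as) (b ∷ bs) →
  ReductionStep (suc (b + k) ∷ as) (b ∷ bs)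
    ((suc k ∸ suc (b + k) % suc k) ∷ consNZ (suc (b + k) % suc k) as) bs
red-greater-step b as k bs bal = record
  { same-cyclicity = begin
      Cyclic (reverse (suc (b + k) ∷ as) ++ b ∷ bs)       ≡⟨ cong Cyclic (reverse-cons-++ _ as (b ∷ bs)) ⟩
      Cyclic (reverse as ++ suc (b + k) ∷ b ∷ bs)         ≡⟨ cong (λ c → Cyclic (reverse as ++ c ∷ b ∷ bs)) (+-suc b k) ⟨
      Cyclic (reverse as ++ (b + D) ∷ b ∷ bs)             ≈⟨ reduce-greater (reverse as) bs D b 1≤b balance ⟩
      Cyclic (reverse as ++ consNZ (b % D) ((D ∸ b % D) ∷ bs)) ≡⟨ cong (λ w → Cyclic (reverse as ++ consNZ w ((D ∸ w) ∷ bs))) same-residue ⟨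
      Cyclic (reverse as ++ consNZ u (v ∷ bs))            ≡⟨ cong Cyclic (reverse-consNZ-++ u as (v ∷ bs)) ⟨
      Cyclic (reverse (consNZ u as) ++ v ∷ bs)            ≡⟨ cong Cyclic (reverse-cons-++ v (consNZ u as) bs) ⟨
      Cyclic (reverse (v ∷ consNZ u as) ++ bs)            ∎
  ; balanced = record
      { pos-left  = v-positive (suc (b + k)) D ∷ positive-consNZ u (tail pos-left)
      ; pos-right = tail pos-right
      ; halves    = trans sum-left (sym sum-bs)
      ; nonempty  = ≤-trans (v-positive (suc (b + k)) D) (m≤m+n v _)
      }
  ; smaller = subst₂ _<_ (sym sum-left) (cong (_+ sum as) (+-suc b k)) (+-monoˡ-< (sum as) (m<n+m D 1≤b))
  }
  where
  open ⇔-Reasoning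
  open Balanced bal
  D u v : ℕ
  D = suc k
  u = suc (b + k) % D
  v = D ∸ u
  1≤b : 1 ≤ b
  1≤b = head pos-right
  same-residue : u ≡ b % D
  same-residue = trans (cong (_% D) (sym (+-suc b k))) ([m+n]%n≡m%n b D)
  sum-bs : sum bs ≡ D + sum as
  sum-bs = halves-differ b D (sum bs) (sum as) (sym (trans (cong (_+ sum as) (+-suc b k)) halves))
  balance : sum bs ≡ sum (reverse as) + D
  balance = trans sum-bs (trans (+-comm D (sum as)) (cong (_+ D) (sym (sum-reverse as))))
  sum-left : v + sum (consNZ u as) ≡ D + sum as
  sum-left = trans (cong (v +_) (sum-consNZ u as)) (trans (sym (+-assoc v u (sum as))) (cong (_+ sum as) (v+u≡D (suc (b + k)) D)))

red-step : ∀ a as b bs → a ≢ b → Balanced (a ∷ as) (b ∷ bs) →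
           ReductionStep (a ∷ as) (b ∷ bs) (proj₁ (red a as b bs)) (proj₂ (red a as b bs))
red-step a as b bs a≢b bal with compare a b
... | less    _ k = red-less-step a as k bs bal
... | equal   _   = ⊥-elim (a≢b refl)
... | greater _ k = red-greater-step b as k bs bal

stopping-swap₁ : ∀ X a Y → 1 ≤ a → sum X ≡ sum Y → revLayered (X ++ a ∷ a ∷ Y) (sum X + a) ≡ sum X + a + a
stopping-swap₁ X a Y 1≤a same = begin
  revLayered (X ++ a ∷ a ∷ Y) (sum X + a) ≡⟨ revLayered-++ʳ X (a ∷ a ∷ Y) a (1≤a , m≤m+n a _) ⟩
  revLayered (a ∷ a ∷ Y) a                ≡⟨ revLayered-first a (a ∷ Y) a ≤-refl ⟩
  a + sum Y + a                           ≡⟨ cong (_+ a) (trans (+-comm a (sum Y)) (cong (_+ a) (sym same))) ⟩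
  sum X + a + a                           ∎
  where open ≡-Reasoning

stopping-swap₂ : ∀ X a Y → 1 ≤ a → sum X ≡ sum Y → revLayered (X ++ a ∷ a ∷ Y) (sum X + a + a) ≡ sum X + a
stopping-swap₂ X a Y 1≤a same = begin
  revLayered (X ++ a ∷ a ∷ Y) (sum X + a + a)   ≡⟨ cong (revLayered (X ++ a ∷ a ∷ Y)) (+-assoc (sum X) a a) ⟩
  revLayered (X ++ a ∷ a ∷ Y) (sum X + (a + a)) ≡⟨ revLayered-++ʳ X (a ∷ a ∷ Y) (a + a) (≤-trans 1≤a (m≤m+n a a) , +-monoʳ-≤ a (m≤m+n a (sum Y))) ⟩
  revLayered (a ∷ a ∷ Y) (a + a)                ≡⟨ revLayered-rest a (a ∷ Y) a (1≤a , m≤m+n a (sum Y)) ⟩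
  revLayered (a ∷ Y) a                          ≡⟨ revLayered-first a Y a ≤-refl ⟩
  sum Y + a                                     ≡⟨ cong (_+ a) same ⟨
  sum X + a                                     ∎
  where open ≡-Reasoning

-- Since the orbit of p + a under a cyclic π contains 1 and p + 2a > 1, we get
-- p + a = 1: the stopping configuration is (1 | 1).
terminal : ∀ a as bs → Balanced (a ∷ as) (a ∷ bs) → Cyclic (reverse (a ∷ as) ++ a ∷ bs) →
           a ≡ 1 × as ≡ [] × bs ≡ []
terminal a as bs bal cyc₀ = conclude (swap-orbit f (stopping-swap₁ X a bs 1≤a p≡bs) (stopping-swap₂ X a bs 1≤a p≡bs) k)
  where
  open Balanced bal
  X : List ℕ
  X = reverse as
  p : ℕ
  p = sum X
  f : ℕ → ℕ
  f = revLayered (X ++ a ∷ a ∷ bs)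
  1≤a : 1 ≤ a
  1≤a = head pos-left
  p≡bs : p ≡ sum bs
  p≡bs = trans (sum-reverse as) (+-cancelˡ-≡ a (sum as) (sum bs) halves)
  1≤p+a : 1 ≤ p + a
  1≤p+a = ≤-trans 1≤a (m≤n+m a p)
  p+a≤n : p + a ≤ sum (X ++ a ∷ a ∷ bs)
  p+a≤n = subst (p + a ≤_) (sym (sum-++ X (a ∷ a ∷ bs))) (+-monoʳ-≤ p (m≤m+n a _))
  hits-1 : Σ ℕ λ k → iter f k (p + a) ≡ 1
  hits-1 = subst Cyclic (reverse-cons-++ a as (a ∷ bs)) cyc₀ (p + a) 1 1≤p+a p+a≤n ≤-refl (≤-trans 1≤p+a p+a≤n)
  k : ℕ
  k = proj₁ hits-1
  conclude : iter f k (p + a) ≡ p + a ⊎ iter f k (p + a) ≡ p + a + a → a ≡ 1 × as ≡ [] × bs ≡ []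
  conclude (inj₁ e) = a≡1 , positive-sum-zero as (tail pos-left) (trans (sym (sum-reverse as)) p≡0)
                          , positive-sum-zero bs (tail pos-right) (trans (sym p≡bs) p≡0)
    where
    p+a≡1 : p + a ≡ 1
    p+a≡1 = trans (sym e) (proj₂ hits-1)
    p≡0 : p ≡ 0
    p≡0 = n≤0⇒n≡0 (subst (p ≤_) (m≤n⇒m∸n≡0 1≤a) (m+n≤o⇒m≤o∸n p (≤-reflexive p+a≡1)))
    a≡1 : a ≡ 1
    a≡1 = trans (cong (_+ a) (sym p≡0)) p+a≡1
  conclude (inj₂ e) = ⊥-elim (<⇒≢ (+-mono-≤ 1≤p+a 1≤a) (sym (trans (sym e) (proj₂ hits-1))))

-- A single block is trivially cyclic, and (1 | 1) arises from it by equalization.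
cyclic-1|1 : Cyclic (1 ∷ 1 ∷ [])
cyclic-1|1 = Equivalence.from (insert-gap [ 1 ] []) single
  where
  single : Cyclic [ 1 ]
  single i j 1≤i i≤1 1≤j j≤1 = 0 , trans (≤-antisym i≤1 1≤i) (≤-antisym 1≤j j≤1)

stops⇒cyclic : ∀ {L R} → RedStops L R [ 1 ] [ 1 ] → Balanced L R → Cyclic (reverse L ++ R)
stops⇒cyclic (stop _ _ _) _ = cyclic-1|1
stops⇒cyclic (step a as b bs a≢b rest) bal = Equivalence.from same-cyclicity (stops⇒cyclic rest balanced)
  where open ReductionStep (red-step a as b bs a≢b bal)

cyclic⇒stops : ∀ {L R} → Acc _<_ (sum L) → Balanced L R → Cyclic (reverse L ++ R) → RedStops L R [ 1 ] [ 1 ]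
cyclic⇒stops {[]}     _ bal _ = ⊥-elim (<⇒≱ (Balanced.nonempty bal) z≤n)
cyclic⇒stops {_ ∷ _} {[]} _ bal _ = ⊥-elim (<⇒≱ (Balanced.nonempty bal) (≤-reflexive (Balanced.halves bal)))
cyclic⇒stops {a ∷ as} {b ∷ bs} (acc rs) bal cyc with a ≟ b
... | yes refl with terminal a as bs bal cyc
...   | refl , refl , refl = stop 1 [] []
cyclic⇒stops {a ∷ as} {b ∷ bs} (acc rs) bal cyc | no a≢b =
  step a as b bs a≢b (cyclic⇒stops (rs smaller) balanced (Equivalence.to same-cyclicity cyc))
  where open ReductionStep (red-step a as b bs a≢b bal)

splitAux-sound : ∀ T seen s xs L R → s ≡ sum seen → splitAux T seen s xs ≡ just (L , R) →
                 reverse seen ++ xs ≡ reverse L ++ R × 2 * sum L ≡ T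
splitAux-sound T seen s xs L R s≡ eq with 2 * s ≟ T
splitAux-sound T seen s xs .seen .xs s≡ refl | yes 2s≡T = refl , trans (cong (2 *_) (sym s≡)) 2s≡T
splitAux-sound T seen s [] L R s≡ () | no _
splitAux-sound T seen s (a ∷ as) L R s≡ eq | no _
  with splitAux-sound T (a ∷ seen) (s + a) as L R (trans (cong (_+ a) s≡) (+-comm _ a)) eq
... | same , half = trans (sym (reverse-cons-++ a seen as)) same , half

splitAux-complete : ∀ T seen s ys zs → 2 * (s + sum ys) ≡ T →
                    Σ (List ℕ) λ L → Σ (List ℕ) λ R → splitAux T seen s (ys ++ zs) ≡ just (L , R)
splitAux-complete T seen s ys zs half with 2 * s ≟ T
... | yes _ = seen , ys ++ zs , refl
splitAux-complete T seen s [] zs half | no 2s≢T = ⊥-elim (2s≢T (trans (cong (2 *_) (sym (+-identityʳ s))) half))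
splitAux-complete T seen s (y ∷ ys) zs half | no _ =
  splitAux-complete T (y ∷ seen) (s + y) ys zs (trans (cong (2 *_) (+-assoc s y (sum ys))) half)

split-balanced : ∀ E L R → splitHalf E ≡ just (L , R) → Positive E → 0 < sum E →
                 E ≡ reverse L ++ R × Balanced L R
split-balanced E L R split pos 0<n with splitAux-sound (sum E) [] 0 E L R refl split
... | E≡ , half = E≡ , record
  { pos-left  = positive-reverse⁻ L (proj₁ parts)
  ; pos-right = proj₂ parts
  ; halves    = +-cancelˡ-≡ (sum L) (sum L) (sum R) (trans (cong (sum L +_) (sym (+-identityʳ (sum L)))) (trans half sum-E))
  ; nonempty  = *-cancelˡ-< 2 0 (sum L) (subst (0 <_) (sym half) 0<n)
  }
  where
  parts : Positive (reverse L) × Positive R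
  parts = ++⁻ (reverse L) (subst Positive E≡ pos)
  sum-E : sum E ≡ sum L + sum R
  sum-E = trans (cong sum E≡) (trans (sum-++ (reverse L) R) (cong (_+ sum R) (sum-reverse L)))

-- The equalization procedure inserts ∣ sum P - sum Q ∣ at some division C = P ++ Q.
-- (Which division it chooses is irrelevant for cyclicity.)
eqAux-shape : ∀ n seen s xs → s ≡ sum seen → s + sum xs ≡ n → 0 < n → 2 * s ≤ n →
  Σ (List ℕ) λ P → Σ (List ℕ) λ Q → eqAux n seen s xs ≡ P ++ ∣ sum P - sum Q ∣ ∷ Q × reverse seen ++ xs ≡ P ++ Q
eqAux-shape .(s + 0) seen s [] s≡ refl 0<n 2s≤n =
  ⊥-elim (<⇒≱ 0<n (≤-trans (≤-reflexive (+-identityʳ s)) (+-cancelˡ-≤ s s 0 2s≤s)))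
  where
  2s≤s : s + s ≤ s + 0
  2s≤s = subst (_≤ s + 0) (cong (s +_) (+-identityʳ s)) 2s≤n
eqAux-shape n seen s (a ∷ rest) s≡ s+≡n 0<n 2s≤n with n <? 2 * (s + a)
... | no n≮ with eqAux-shape n (a ∷ seen) (s + a) rest (trans (cong (_+ a) s≡) (+-comm _ a))
                   (trans (+-assoc s a _) s+≡n) 0<n (≮⇒≥ n≮)
...   | P , Q , eq , C≡ = P , Q , eq , trans (sym (reverse-cons-++ a seen rest)) C≡
eqAux-shape n seen s (a ∷ rest) s≡ s+≡n 0<n 2s≤n | yes _ with s ≤? sum rest
... | yes _ = reverse (a ∷ seen) , rest ,
        cong (λ m → reverse (a ∷ seen) ++ ∣ m - sum rest ∣ ∷ rest)
             (trans (cong (_+ a) s≡) (trans (+-comm _ a) (sym (sum-reverse (a ∷ seen))))) ,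
        sym (reverse-cons-++ a seen rest)
... | no _ = reverse seen , a ∷ rest ,
        cong (λ m → reverse seen ++ ∣ m - (a + sum rest) ∣ ∷ a ∷ rest) (trans s≡ (sym (sum-reverse seen))) ,
        refl

eqC-balanced : ∀ C {x} → splitHalf C ≡ just x → eqC C ≡ C
eqC-balanced C split with splitHalf C
... | just _ = refl

eqC-unbalanced : ∀ C → splitHalf C ≡ nothing → eqC C ≡ eqAux (sum C) [] 0 C
eqC-unbalanced C split with splitHalf C
... | nothing = refl

record BalancedForm (C : List ℕ) : Set where
  field
    left right     : List ℕ
    splits         : splitHalf (eqC C) ≡ just (left , right)
    balanced       : Balanced left right
    same-cyclicity : Cyclic C ⇔ Cyclic (reverse left ++ right)

from-equalized : ∀ C E L R → eqC C ≡ E → splitHalf E ≡ just (L , R) → Positive E → 0 < sum E →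
                 (Cyclic C ⇔ Cyclic E) → BalancedForm C
from-equalized C E L R eq split pos 0<n same with split-balanced E L R split pos 0<n
... | E≡ , bal = record
  { left = L ; right = R
  ; splits = trans (cong splitHalf eq) split
  ; balanced = bal
  ; same-cyclicity = ⇔.trans same (subst (λ F → Cyclic E ⇔ Cyclic F) E≡ ⇔.refl)
  }

equal-parts-split : ∀ ys zs → sum ys ≡ sum zs → Σ (List ℕ) λ L → Σ (List ℕ) λ R → splitHalf (ys ++ zs) ≡ just (L , R)
equal-parts-split ys zs same = splitAux-complete (sum (ys ++ zs)) [] 0 ys zs
  (trans (cong (sum ys +_) (trans (+-identityʳ (sum ys)) same)) (sym (sum-++ ys zs)))

-- Inserting U = ∣ sum P - sum Q ∣ into an unbalanced C = P ++ Q yields a balanced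
-- composition; U is positive since otherwise P would already be a half of C.
insertion-form : ∀ P Q → eqC (P ++ Q) ≡ P ++ ∣ sum P - sum Q ∣ ∷ Q → splitHalf (P ++ Q) ≡ nothing →
                 Positive (P ++ Q) → 0 < sum (P ++ Q) → BalancedForm (P ++ Q)
insertion-form P Q eqC≡ unsplit pos 0<n =
  from-equalized (P ++ Q) E (proj₁ splits-E) (proj₁ (proj₂ splits-E)) eqC≡ (proj₂ (proj₂ splits-E))
    (++⁺ (proj₁ parts) (0<U ∷ proj₂ parts)) 0<sumE (⇔.sym (insert-gap P Q))
  where
  U : ℕ
  U = ∣ sum P - sum Q ∣
  E : List ℕ
  E = P ++ U ∷ Q
  parts : Positive P × Positive Q
  parts = ++⁻ P pos
  0<U : 0 < U
  0<U with U in U≡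
  ... | suc _ = z<s
  ... | zero with equal-parts-split P Q (∣m-n∣≡0⇒m≡n U≡)
  ...   | _ , _ , split with trans (sym unsplit) split
  ...     | ()
  0<sumE : 0 < sum E
  0<sumE = subst (0 <_) (sym (sum-++ P (U ∷ Q)))
             (≤-trans (subst (0 <_) (sum-++ P Q) 0<n) (+-monoʳ-≤ (sum P) (m≤n+m (sum Q) U)))
  splits-E : Σ (List ℕ) λ L → Σ (List ℕ) λ R → splitHalf E ≡ just (L , R)
  splits-E with ≤-total (sum Q) (sum P)
  ... | inj₁ Q≤P = equal-parts-split P (U ∷ Q)
          (sym (trans (cong (_+ sum Q) (m≤n⇒∣n-m∣≡n∸m Q≤P)) (m∸n+n≡m Q≤P)))
  ... | inj₂ P≤Q = subst (λ F → Σ (List ℕ) λ L → Σ (List ℕ) λ R → splitHalf F ≡ just (L , R))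
          (++-assoc P [ U ] Q)
          (equal-parts-split (P ++ [ U ]) Q
            (trans (sum-++ P [ U ]) (trans (cong (sum P +_) (trans (+-identityʳ U) (m≤n⇒∣m-n∣≡n∸m P≤Q))) (m+[n∸m]≡n P≤Q))))

unbalanced-form : ∀ C → splitHalf C ≡ nothing → Positive C → 0 < sum C → BalancedForm C
unbalanced-form C unsplit pos 0<n with eqAux-shape (sum C) [] 0 C refl refl 0<n z≤n
... | P , Q , eq , refl = insertion-form P Q (trans (eqC-unbalanced (P ++ Q) unsplit) eq) unsplit pos 0<n

balanced-form : ∀ C → Positive C → 0 < sum C → BalancedForm C
balanced-form C pos 0<n with splitHalf C in split
... | just (L , R) = from-equalized C C L R (eqC-balanced C split) split pos 0<n ⇔.refl
... | nothing      = unbalanced-form C split pos 0<n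

mainTheorem2 : (n : ℕ) (C : List ℕ) → 0 < n → All (0 <_) C → sum C ≡ n →
  (Cyclic C ⇔ Σ (List ℕ) λ Lr → Σ (List ℕ) λ R →
     (splitHalf (eqC C) ≡ just (Lr , R)) × RedStops Lr R (1 ∷ []) (1 ∷ []))
mainTheorem2 n C 0<n pos refl = mk⇔ to-stops from-stops
  where
  open BalancedForm (balanced-form C pos 0<n)

  to-stops : Cyclic C → Σ (List ℕ) λ Lr → Σ (List ℕ) λ R →
             (splitHalf (eqC C) ≡ just (Lr , R)) × RedStops Lr R (1 ∷ []) (1 ∷ [])
  to-stops cyc = left , right , splits ,
    cyclic⇒stops (<-wellFounded (sum left)) balanced (Equivalence.to same-cyclicity cyc)

  -- eqC C has only one split, so the procedure ran on the balanced form.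
  from-stops : (Σ (List ℕ) λ Lr → Σ (List ℕ) λ R →
               (splitHalf (eqC C) ≡ just (Lr , R)) × RedStops Lr R (1 ∷ []) (1 ∷ [])) → Cyclic C
  from-stops (Lr , R , splits′ , stops) with trans (sym splits) splits′
  ... | refl = Equivalence.from same-cyclicity (stops⇒cyclic stops balanced)
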